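{- If a graph $G$ is the union of two comparability graphs, then for every integer $k \ge 1$, the lexicographic power $G^{[k]}$ is also the union of two comparability graphs.
   Context: All graphs are simple, undirected and finite. A comparability graph is a graph admitting a transitive orientation. The union of graphs $G_1,\dots,G_k$ is the graph with vertex set $\bigcup V(G_i)$ and edge set $\bigcup E(G_i)$. The lexicographic product $G_1 \circ G_2$ has vertex set $V(G_1)\times V(G_2)$, with $(u,v)$ and $(x,y)$ adjacent iff $\{u,x\}\in E(G_1)$, or $u=x$ and $\{v,y\}\in E(G_2)$. The lexicographic power is $G^{[1]} = G$, $G^{[k]} = G^{[k-1]} \circ G$ for $k\ge 2$. -}

module Defs where

open import Data.Nat using (ℕ; zero; suc; _*_)
open import Data.Fin using (Fin)
open import Data.Fin.Properties using (*↔×)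
open import Data.Product using (Σ; _×_; _,_; proj₁; proj₂)
open import Data.Sum using (_⊎_)
open import Data.Empty using (⊥)
open import Relation.Nullary using (¬_)
open import Relation.Binary.PropositionalEquality using (_≡_)
open import Function.Bundles using (_↔_)
open import Function.Properties.Inverse using (↔-trans; ↔-sym)
open import Data.Product.Function.NonDependent.Propositional using (_×-↔_)

record Graph : Set₁ where
  field
    Vertex : Set
    size   : ℕ
    finite : Vertex ↔ Fin size
    Adj    : Vertex → Vertex → Set
    sym    : ∀ {u v} → Adj u v → Adj v u
    irrefl : ∀ {u} → ¬ Adj u u

open Graph public

record TransitiveOrientation {V : Set} (E : V → V → Set) : Set₁ where
  field
    Arc        : V → V → Set
    arc⇒edge   : ∀ {u v} → Arc u v → E u v
    edge⇒arc   : ∀ {u v} → E u v → Arc u v ⊎ Arc v u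
    antisym    : ∀ {u v} → Arc u v → Arc v u → ⊥
    transitive : ∀ {u v w} → Arc u v → Arc v w → Arc u w

IsComparability : Graph → Set₁
IsComparability G = TransitiveOrientation (Adj G)

-- G is the union of two comparability graphs: there are two comparability
-- graphs H₁, H₂ whose vertex sets are (subsets of) V(G) -- taken here as
-- spanning subgraphs on V(G) -- with E(G) = E(H₁) ∪ E(H₂).
record UnionOfTwoComparability (G : Graph) : Set₁ where
  field
    E₁ E₂   : Vertex G → Vertex G → Set
    sym₁    : ∀ {u v} → E₁ u v → E₁ v u
    sym₂    : ∀ {u v} → E₂ u v → E₂ v u
    comp₁   : TransitiveOrientation E₁
    comp₂   : TransitiveOrientation E₂
    covers  : ∀ {u v} → Adj G u v → E₁ u v ⊎ E₂ u v
    sub₁    : ∀ {u v} → E₁ u v → Adj G u v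
    sub₂    : ∀ {u v} → E₂ u v → Adj G u v

lexAdj : (G₁ G₂ : Graph) → Vertex G₁ × Vertex G₂ → Vertex G₁ × Vertex G₂ → Set
lexAdj G₁ G₂ (u , v) (x , y) = Adj G₁ u x ⊎ (u ≡ x × Adj G₂ v y)

_∘ₗ_ : Graph → Graph → Graph
G₁ ∘ₗ G₂ = record
  { Vertex = Vertex G₁ × Vertex G₂
  ; size   = size G₁ * size G₂
  ; finite = ↔-trans (finite G₁ ×-↔ finite G₂) (↔-sym *↔×)
  ; Adj    = lexAdj G₁ G₂
  ; sym    = symL
  ; irrefl = irrL
  }
  where
  open import Data.Sum using (inj₁; inj₂)
  open import Relation.Binary.PropositionalEquality using (refl)
  symL : ∀ {p q} → lexAdj G₁ G₂ p q → lexAdj G₁ G₂ q p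
  symL (inj₁ a) = inj₁ (sym G₁ a)
  symL (inj₂ (refl , a)) = inj₂ (refl , sym G₂ a)
  irrL : ∀ {p} → ¬ lexAdj G₁ G₂ p p
  irrL (inj₁ a) = irrefl G₁ a
  irrL (inj₂ (_ , a)) = irrefl G₂ a

-- Lexicographic power: G^[1] = G, G^[k] = G^[k-1] ∘ G for k ≥ 2.
-- (The index 0 is never used; it is set to G only to make the function total.)
_^[_] : Graph → ℕ → Graph
G ^[ zero ]          = G
G ^[ suc zero ]      = G
G ^[ suc (suc k) ]   = (G ^[ suc k ]) ∘ₗ G

module Submission where

open import Defs
open import Data.Nat using (ℕ; _≤_; zero; suc)
open import Data.Product using (_×_; _,_)
open import Data.Sum using (_⊎_; inj₁; inj₂)
open import Data.Empty using (⊥)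
open import Level using (0ℓ)
open import Relation.Binary.Core using (Rel; _⇒_)
open import Relation.Binary.Definitions using (Symmetric)
open import Relation.Binary.Construct.Union using (_∪_)
open import Relation.Binary.PropositionalEquality using (_≡_; refl)

-- If E(G) = E₁ ∪ E₂ and E(H) = F₁ ∪ F₂ with all four relations transitively
-- orientable, then E(G ∘ H) = Lex E₁ F₁ ∪ Lex E₂ F₂, and the lexicographic
-- relation of two transitive orientations is again a transitive orientation.

module _ {V W : Set} where

  -- Lex (Adj G) (Adj H) is definitionally the adjacency lexAdj G H of G ∘ₗ H.
  Lex : Rel V 0ℓ → Rel W 0ℓ → Rel (V × W) 0ℓ
  Lex E F (u , v) (x , y) = E u x ⊎ (u ≡ x × F v y)

  Lex-mono : ∀ {E E′ : Rel V 0ℓ} {F F′ : Rel W 0ℓ} →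
    E ⇒ E′ → F ⇒ F′ → Lex E F ⇒ Lex E′ F′
  Lex-mono E⇒E′ F⇒F′ {_ , _} {_ , _} (inj₁ e)         = inj₁ (E⇒E′ e)
  Lex-mono E⇒E′ F⇒F′ {_ , _} {_ , _} (inj₂ (u≡x , f)) = inj₂ (u≡x , F⇒F′ f)

  Lex-symmetric : ∀ {E : Rel V 0ℓ} {F : Rel W 0ℓ} →
    Symmetric E → Symmetric F → Symmetric (Lex E F)
  Lex-symmetric symE symF {_ , _} {_ , _} (inj₁ e)          = inj₁ (symE e)
  Lex-symmetric symE symF {_ , _} {_ , _} (inj₂ (refl , f)) = inj₂ (refl , symF f)

  Lex-distrib-∪ : ∀ {E₁ E₂ : Rel V 0ℓ} {F₁ F₂ : Rel W 0ℓ} →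
    Lex (E₁ ∪ E₂) (F₁ ∪ F₂) ⇒ Lex E₁ F₁ ∪ Lex E₂ F₂
  Lex-distrib-∪ {x = _ , _} {_ , _} (inj₁ (inj₁ e))      = inj₁ (inj₁ e)
  Lex-distrib-∪ {x = _ , _} {_ , _} (inj₁ (inj₂ e))      = inj₂ (inj₁ e)
  Lex-distrib-∪ {x = _ , _} {_ , _} (inj₂ (eq , inj₁ f)) = inj₁ (inj₂ (eq , f))
  Lex-distrib-∪ {x = _ , _} {_ , _} (inj₂ (eq , inj₂ f)) = inj₂ (inj₂ (eq , f))

  Lex-transitiveOrientation : ∀ {E : Rel V 0ℓ} {F : Rel W 0ℓ} →
    TransitiveOrientation E → TransitiveOrientation F →
    TransitiveOrientation (Lex E F)
  Lex-transitiveOrientation {E} {F} O P = record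
    { Arc        = Lex O.Arc P.Arc
    ; arc⇒edge   = Lex-mono {E = O.Arc} {F = P.Arc} O.arc⇒edge P.arc⇒edge
    ; edge⇒arc   = edge⇒arc
    ; antisym    = antisym
    ; transitive = transitive
    }
    where
    module O = TransitiveOrientation O
    module P = TransitiveOrientation P

    edge⇒arc : ∀ {p q} → Lex E F p q → Lex O.Arc P.Arc p q ⊎ Lex O.Arc P.Arc q p
    edge⇒arc {_ , _} {_ , _} (inj₁ e) with O.edge⇒arc e
    ... | inj₁ a = inj₁ (inj₁ a)
    ... | inj₂ a = inj₂ (inj₁ a)
    edge⇒arc {_ , _} {_ , _} (inj₂ (refl , f)) with P.edge⇒arc f
    ... | inj₁ b = inj₁ (inj₂ (refl , b))
    ... | inj₂ b = inj₂ (inj₂ (refl , b))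

    -- The mixed cases contradict antisymmetry of O on a loop u → u.
    antisym : ∀ {p q} → Lex O.Arc P.Arc p q → Lex O.Arc P.Arc q p → ⊥
    antisym {_ , _} {_ , _} (inj₁ a)          (inj₁ a′)         = O.antisym a a′
    antisym {_ , _} {_ , _} (inj₁ a)          (inj₂ (refl , _)) = O.antisym a a
    antisym {_ , _} {_ , _} (inj₂ (refl , _)) (inj₁ a)          = O.antisym a a
    antisym {_ , _} {_ , _} (inj₂ (refl , b)) (inj₂ (_ , b′))   = P.antisym b b′

    transitive : ∀ {p q r} →
      Lex O.Arc P.Arc p q → Lex O.Arc P.Arc q r → Lex O.Arc P.Arc p r
    transitive {_ , _} {_ , _} {_ , _} (inj₁ a)          (inj₁ a′)          = inj₁ (O.transitive a a′)
    transitive {_ , _} {_ , _} {_ , _} (inj₁ a)          (inj₂ (refl , _))  = inj₁ a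
    transitive {_ , _} {_ , _} {_ , _} (inj₂ (refl , _)) (inj₁ a)           = inj₁ a
    transitive {_ , _} {_ , _} {_ , _} (inj₂ (refl , b)) (inj₂ (refl , b′)) = inj₂ (refl , P.transitive b b′)

∘ₗ-unionOfTwoComparability : (G H : Graph) →
  UnionOfTwoComparability G → UnionOfTwoComparability H →
  UnionOfTwoComparability (G ∘ₗ H)
∘ₗ-unionOfTwoComparability G H U V = record
  { E₁     = Lex U.E₁ V.E₁
  ; E₂     = Lex U.E₂ V.E₂
  ; sym₁   = Lex-symmetric {E = U.E₁} {V.E₁} U.sym₁ V.sym₁
  ; sym₂   = Lex-symmetric {E = U.E₂} {V.E₂} U.sym₂ V.sym₂
  ; comp₁  = Lex-transitiveOrientation U.comp₁ V.comp₁
  ; comp₂  = Lex-transitiveOrientation U.comp₂ V.comp₂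
  ; covers = λ adj → Lex-distrib-∪ {E₁ = U.E₁} {U.E₂} {V.E₁} {V.E₂}
                 (Lex-mono {E = Adj G} {F = Adj H} U.covers V.covers adj)
  ; sub₁   = Lex-mono {E = U.E₁} {F = V.E₁} U.sub₁ V.sub₁
  ; sub₂   = Lex-mono {E = U.E₂} {F = V.E₂} U.sub₂ V.sub₂
  }
  where
  module U = UnionOfTwoComparability U
  module V = UnionOfTwoComparability V

^[suc]-unionOfTwoComparability : (G : Graph) → UnionOfTwoComparability G →
  (k : ℕ) → UnionOfTwoComparability (G ^[ suc k ])
^[suc]-unionOfTwoComparability G U zero    = U
^[suc]-unionOfTwoComparability G U (suc k) =
  ∘ₗ-unionOfTwoComparability (G ^[ suc k ]) G
    (^[suc]-unionOfTwoComparability G U k) U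

mainTheorem8 : (G : Graph) → UnionOfTwoComparability G →
    (k : ℕ) → 1 ≤ k → UnionOfTwoComparability (G ^[ k ])
mainTheorem8 G U (suc k) _ = ^[suc]-unionOfTwoComparability G U k
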